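{- Let $b\ge 1$ and $k\ge b+1$ be integers, and let $\mathcal{E}$ be an arbitrary equation. Then $\operatorname{GR}_k(y=x+b:\mathcal{E})=k$.
   Context: All colorings are exact: an exact $k$-coloring of $[n]=\{1,\dots,n\}$ is a surjective map $[n]\to[k]$ (so $n\ge k$). A solution of an equation in $[n]$ is an assignment of values in $[n]$ to its variables satisfying it; it is rainbow if all these values receive pairwise distinct colors, and monochromatic if they all receive the same color. In particular a rainbow solution of $y=x+b$ is a pair $x_0,x_0+b\in[n]$ of different colors. The Gallai--Rado number $\operatorname{GR}_k(\mathcal{E}_1:\mathcal{E}_2)$ is the minimum integer $N\ge k$, if it exists, such that for all $n\ge N$, every exact $k$-coloring of $[n]$ contains either a rainbow solution of $\mathcal{E}_1$ or a monochromatic solution of $\mathcal{E}_2$. -}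

module Defs where

open import Data.Nat using (ℕ; suc; _+_; _≤_)
open import Data.Fin using (Fin; toℕ; zero; suc)
open import Data.Product using (Σ; ∃; _×_)
open import Data.Sum using (_⊎_)
open import Relation.Nullary using (¬_)
open import Relation.Binary.PropositionalEquality using (_≡_; _≢_)

-- An equation in m variables: an arbitrary predicate on assignments of
-- (positive) natural-number values to its variables.
record Equation : Set₁ where
  field
    vars  : ℕ
    holds : (Fin vars → ℕ) → Set
open Equation public

-- The element i : Fin n represents the integer (toℕ i + 1) ∈ [n] = {1,…,n}.
val : ∀ {n} → Fin n → ℕ
val i = suc (toℕ i)

ExactColoring : ℕ → ℕ → Set
ExactColoring n k = Σ (Fin n → Fin k) λ c → ∀ (j : Fin k) → ∃ λ i → c i ≡ j

Solution : (E : Equation) → ℕ → Set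
Solution E n = Σ (Fin (vars E) → Fin n) λ s → holds E (λ v → val (s v))

HasRainbow : ∀ {n k} → ExactColoring n k → Equation → Set
HasRainbow {n} (c Data.Product., _) E =
  Σ (Solution E n) λ sol → ∀ (u v : Fin (vars E)) → u ≢ v →
    c (Data.Product.proj₁ sol u) ≢ c (Data.Product.proj₁ sol v)

HasMono : ∀ {n k} → ExactColoring n k → Equation → Set
HasMono {n} (c Data.Product., _) E =
  Σ (Solution E n) λ sol → ∀ (u v : Fin (vars E)) →
    c (Data.Product.proj₁ sol u) ≡ c (Data.Product.proj₁ sol v)

GRProperty : ℕ → Equation → Equation → ℕ → Set
GRProperty k E₁ E₂ n = ∀ (χ : ExactColoring n k) → HasRainbow χ E₁ ⊎ HasMono χ E₂

IsGallaiRado : ℕ → Equation → Equation → ℕ → Set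
IsGallaiRado k E₁ E₂ N =
  k ≤ N × (∀ n → N ≤ n → GRProperty k E₁ E₂ n)
        × (∀ M → k ≤ M → (∀ n → M ≤ n → GRProperty k E₁ E₂ n) → N ≤ M)

-- The equation y = x + b, with variables x = zero, y = suc zero.
translationEq : ℕ → Equation
translationEq b = record { vars = 2 ; holds = λ s → s (suc zero) ≡ s zero + b }

-- If some translate x, x + b of [n] is not rainbow, every pair x, x + b is
-- monochromatic, so the colour of x depends only on x mod b. An exact colouring
-- then uses at most b < k colours, which is absurd; hence every exact k-colouring
-- has a rainbow solution of y = x + b, whatever the second equation is.
module Submission where

open import Defs
open import Data.Nat as ℕ using (ℕ; suc; _≤_; _<_; _+_; _*_; _%_; _/_; NonZero)
open import Data.Nat.Properties 
  using (≤-refl; ≤-reflexive; ≤-trans; ≤-<-trans; <⇒≱; m≤m+n; +-comm; +-assoc; +-identityʳ)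
open import Data.Nat.DivMod using (m%n≤m; m%n<n; m≡m%n+[m/n]*n)
open import Data.Fin using (Fin; toℕ; fromℕ<; zero; suc; _≟_)
open import Data.Fin.Properties
  using (toℕ<n; toℕ-fromℕ<; fromℕ<-cong; fromℕ<-injective; toℕ-injective; any?; injective⇒≤)
open import Data.Product using (∃; ∃₂; _×_; _,_; proj₁)
open import Data.Sum using (_⊎_; inj₁; inj₂)
open import Data.Empty using (⊥-elim)
open import Relation.Nullary using (yes; no)
open import Relation.Nullary.Decidable using (_×-dec_; ¬?; decidable-stable)
open import Relation.Binary.PropositionalEquality
open import Function using (_∘_)
open ≡-Reasoning

Periodic : ∀ {a} {A : Set a} {n} → ℕ → (Fin n → A) → Set a
Periodic b c = ∀ i j → toℕ j ≡ toℕ i + b → c i ≡ c j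

module _ {a} {A : Set a} {n b : ℕ} {c : Fin n → A} (periodic : Periodic b c) where

  periodic⇒multiplePeriodic : ∀ q i j → toℕ j ≡ toℕ i + q * b → c i ≡ c j
  periodic⇒multiplePeriodic ℕ.zero i j j≡i+0 =
    cong c (toℕ-injective (trans (sym (+-identityʳ (toℕ i))) (sym j≡i+0)))
  periodic⇒multiplePeriodic (suc q) i j j≡i+b+qb =
    trans (periodic i m (toℕ-fromℕ< i+b<n))
          (periodic⇒multiplePeriodic q m j (begin
            toℕ j                ≡⟨ j≡i+b+qb ⟩
            toℕ i + (b + q * b)  ≡⟨ +-assoc (toℕ i) b (q * b) ⟨
            toℕ i + b + q * b    ≡⟨ cong (_+ q * b) (toℕ-fromℕ< i+b<n) ⟨
            toℕ m + q * b        ∎))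
    where
    i+b<n : toℕ i + b < n
    i+b<n = ≤-<-trans (≤-trans (m≤m+n (toℕ i + b) (q * b))
                             (≤-reflexive (trans (+-assoc (toℕ i) b (q * b)) (sym j≡i+b+qb))))
                    (toℕ<n j)
    m : Fin n
    m = fromℕ< i+b<n

  module _ .{{_ : NonZero b}} where

    periodic⇒colourOfResidue : ∀ i → c (fromℕ< (≤-<-trans (m%n≤m (toℕ i) b) (toℕ<n i))) ≡ c i
    periodic⇒colourOfResidue i = periodic⇒multiplePeriodic (toℕ i / b) _ i (begin
      toℕ i                          ≡⟨ m≡m%n+[m/n]*n (toℕ i) b ⟩
      toℕ i % b + toℕ i / b * b      ≡⟨ cong (_+ toℕ i / b * b) (toℕ-fromℕ< _) ⟨
      toℕ (fromℕ< _) + toℕ i / b * b ∎)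

    periodic⇒congMod : ∀ {i j} → toℕ i % b ≡ toℕ j % b → c i ≡ c j
    periodic⇒congMod {i} {j} i%b≡j%b = begin
      c i            ≡⟨ periodic⇒colourOfResidue i ⟨
      c (fromℕ< _)   ≡⟨ cong c (fromℕ<-cong _ _ i%b≡j%b _ _) ⟩
      c (fromℕ< _)   ≡⟨ periodic⇒colourOfResidue j ⟩
      c j            ∎

surjective-periodic⇒≤period : ∀ {n k b} .{{_ : NonZero b}} {c : Fin n → Fin k} →
  Periodic b c → (∀ j → ∃ λ i → c i ≡ j) → k ≤ b
surjective-periodic⇒≤period {b = b} {c} periodic surjective = injective⇒≤ residueOfPreimage-injective
  where
  residueOfPreimage : Fin _ → Fin b
  residueOfPreimage j = fromℕ< (m%n<n (toℕ (proj₁ (surjective j))) b)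

  residueOfPreimage-injective : ∀ {j j′} → residueOfPreimage j ≡ residueOfPreimage j′ → j ≡ j′
  residueOfPreimage-injective {j} {j′} eq with surjective j | surjective j′
  ... | i , refl | i′ , refl = periodic⇒congMod periodic (fromℕ<-injective _ _ _ _ eq)

nonMonochromaticTranslate⊎periodic : ∀ {n k} b (c : Fin n → Fin k) →
  (∃₂ λ i j → toℕ j ≡ toℕ i + b × c i ≢ c j) ⊎ Periodic b c
nonMonochromaticTranslate⊎periodic b c
  with any? (λ i → any? (λ j → (toℕ j ℕ.≟ toℕ i + b) ×-dec ¬? (c i ≟ c j)))
... | yes (i , j , translate) = inj₁ (i , j , translate)
... | no ¬translate = inj₂ λ i j j≡i+b →
  decidable-stable (c i ≟ c j) (λ ci≢cj → ¬translate (i , j , j≡i+b , ci≢cj))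

nonMonochromaticTranslate⇒rainbow : ∀ {n k b} (χ : ExactColoring n k) {i j} →
  toℕ j ≡ toℕ i + b → proj₁ χ i ≢ proj₁ χ j → HasRainbow χ (translationEq b)
nonMonochromaticTranslate⇒rainbow (c , _) {i} {j} j≡i+b ci≢cj =
  (solution , cong suc j≡i+b) , distinct
  where
  solution : Fin 2 → Fin _
  solution zero    = i
  solution (suc _) = j

  distinct : ∀ u v → u ≢ v → c (solution u) ≢ c (solution v)
  distinct zero       zero       u≢v = ⊥-elim (u≢v refl)
  distinct zero       (suc zero) _   = ci≢cj
  distinct (suc zero) zero       _   = ci≢cj ∘ sym
  distinct (suc zero) (suc zero) u≢v = ⊥-elim (u≢v refl)

exactColouring⇒translationRainbow : ∀ {n k b} .{{_ : NonZero b}} → b < k →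
  (χ : ExactColoring n k) → HasRainbow χ (translationEq b)
exactColouring⇒translationRainbow {b = b} b<k χ@(c , surjective)
  with nonMonochromaticTranslate⊎periodic b c
... | inj₁ (_ , _ , j≡i+b , ci≢cj) = nonMonochromaticTranslate⇒rainbow χ j≡i+b ci≢cj
... | inj₂ periodic = ⊥-elim (<⇒≱ b<k (surjective-periodic⇒≤period periodic surjective))

mainTheorem6 : ∀ (b k : ℕ) → 1 ≤ b → b + 1 ≤ k → (E : Equation) →
    IsGallaiRado k (translationEq b) E k
mainTheorem6 (suc b) k _ b+1≤k E =
  ≤-refl , (λ n _ χ → inj₁ (exactColouring⇒translationRainbow b<k χ)) , λ _ k≤M _ → k≤M
  where
  b<k : suc b < k
  b<k = ≤-trans (≤-reflexive (+-comm 1 (suc b))) b+1≤k
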